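{- Let $n,k$ be positive integers and $X=\{(\lambda^{(i)},n_i,s_i):1\le i\le k\}$ where $n_i,s_i$ are positive integers with $s_i+n_i-1\le n$ and $\lambda^{(i)}\in\mathrm{Par}_{n_i}$. For $\mu=(\mu_1,\dots,\mu_n)\in\mathrm{Par}_n$ let $\mu^{[i]}=(\mu_{s_i},\mu_{s_i+1},\dots,\mu_{s_i+n_i-1})$. Then \[ \mathrm{GF}(P_n(X))=q^{ -\sum_{i=1}^n(n-i)\ell_i}\sum_{\substack{\mu\in\mathrm{Par}_n\\ \mu_1>\mu_2>\cdots>\mu_n\ge0}}q^{|\mu|}\prod_{i=1}^k\ \sum_{\substack{T\in\mathrm{SSYT}((\delta_{n_i+1}+\lambda^{(i)})^*)\\ \mathrm{rdiag}(T)=\mu^{[i]}}}q^{|T|-|\mu^{[i]}|}, \] where $\ell_i$ is the number of elements of level $i$ in $P_n(X)$.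
   Context: $\mathrm{Par}_n$: partitions $\mu=(\mu_1\ge\cdots\ge\mu_n\ge0)$; $|\mu|=\sum\mu_i$; $\delta_n=(n-1,n-2,\dots,1,0)$; sums of partitions are componentwise (padding with zeros). For $\lambda\in\mathrm{Par}_n$, $\lambda+\delta_{n+1}=(\lambda_1+n,\lambda_2+n-1,\dots,\lambda_n+1)$ has distinct parts. For a partition $\nu$ with distinct nonzero parts, its shifted diagram $\nu^*$ has $\nu_i$ cells in row $i$, starting in column $i$; its shifted Young poset is the set of cells with $x\le y$ iff $x$ is weakly below and weakly right of $y$; the diagonal cells are the leftmost cells of the rows. A semistandard Young tableau of shifted shape $\nu^*$ is a filling with nonnegative integers weakly increasing along rows and strictly increasing down columns; $\mathrm{SSYT}(\nu^*)$ is the set of these, $|T|$ is the sum of entries, and $\mathrm{rdiag}(T)$ is the sequence of diagonal entries arranged in non-increasing order. Construction: for a poset $P$ containing a chain $C=\{x_1<\cdots<x_m\}$ and $\lambda\in\mathrm{Par}_m$, $D(P,C,\lambda)$ is the poset obtained from the disjoint union of $P$ and the shifted Young poset of $\lambda+\delta_{m+1}$ by identifying $x_m,x_{m-1},\dots,x_1$ with the diagonal cells of rows $1,2,\dots,m$ respectively (order = transitive closure). $P_n(X)$: start with a chain $P_0=\{x_1<\cdots<x_n\}$ (the diagonal entries) and set $P_i=D(P_{i-1},\{x_{s_i}<\cdots<x_{s_i+n_i-1}\},\lambda^{(i)})$ for $i=1,\dots,k$; $P_n(X)=P_k$. An element $y$ is of level $i$ if $y\le x_i$ and $y\not\le x_{i-1}$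 (for $i=1$: $y\le x_1$). For a finite poset $Q$, a $Q$-partition is $\sigma:Q\to\mathbb{N}$ with $x\le y\Rightarrow\sigma(x)\ge\sigma(y)$, and $\mathrm{GF}(Q)=\sum_\sigma q^{\sum_x\sigma(x)}$. -}

module Defs where

open import Level using (0ℓ)
open import Data.Nat using (ℕ; zero; suc; _+_; _*_; _∸_; _≤_; _<_; _≥_; _>_)
open import Data.Nat.Properties using (m∸n≤m; +-monoʳ-≤; +-monoʳ-<; n<1+n; ≤-<-trans; <-≤-trans)
open import Data.Fin using (Fin; zero; suc; toℕ; fromℕ<)
open import Data.Vec using (Vec; lookup; toList)
open import Data.List using (List; map; take; drop; allFin; length)
open import Data.Nat.ListAction using (sum)
open import Data.List.Relation.Unary.Linked using (Linked)
open import Data.List.Relation.Unary.Unique.Propositional using (Unique)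
open import Data.List.Membership.Propositional using (_∈_)
open import Data.List.Relation.Binary.Permutation.Propositional using (_↭_)
open import Data.Product using (Σ; _×_; _,_; proj₁; proj₂)
open import Relation.Binary.PropositionalEquality using (_≡_; refl; sym; trans)
open import Relation.Binary.Construct.Closure.ReflexiveTransitive using (Star)
open import Relation.Binary.Bundles using (Setoid)
open import Function.Bundles using (_⇔_)
open import Relation.Nullary using (¬_)

sumFin : (n : ℕ) → (Fin n → ℕ) → ℕ
sumFin n f = sum (map f (allFin n))

IsPar : ∀ {m} → Vec ℕ m → Set
IsPar v = Linked _≥_ (toList v)

-- One triple (λ^(i), n_i, s_i) of X, for a fixed n.
-- n_i = suc m' and s_i = suc s' (both positive); fits : s_i + n_i - 1 ≤ n.
record Block (n : ℕ) : Set where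
  field
    m'     : ℕ
    s'     : ℕ
    lam    : Vec ℕ (suc m')
    lamPar : IsPar lam
    fits   : s' + suc m' ≤ n
open Block public

-- Shifted diagram of ν = λ + δ_{m+1}, m = n_i = suc m'.
-- Row r (0-indexed) has ν_{r+1} = λ_{r+1} + m - r = suc (λ_{r+1} + (m' ∸ r)) cells.
rowLen : ∀ {n} (b : Block n) → Fin (suc (m' b)) → ℕ
rowLen b r = suc (lookup (lam b) r + (m' b ∸ toℕ r))

-- a cell: (row r, offset e from the diagonal); offset 0 = diagonal cell
SCell : ∀ {n} → Block n → Set
SCell b = Σ (Fin (suc (m' b))) (λ r → Fin (rowLen b r))

row : ∀ {n} (b : Block n) → SCell b → ℕ
row b (r , e) = toℕ r

col : ∀ {n} (b : Block n) → SCell b → ℕ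
col b (r , e) = toℕ r + toℕ e

SLe : ∀ {n} (b : Block n) → SCell b → SCell b → Set
SLe b x y = row b y ≤ row b x × col b y ≤ col b x

-- index (0-based) of the chain element identified with the diagonal cell of row r:
-- row r+1 (1-based) ↔ x_{s_i + n_i - (r+1)}, 0-based index s' + (m' - r)
diagIdx : ∀ {n} (b : Block n) → Fin (suc (m' b)) → Fin n
diagIdx b r = fromℕ< {s' b + (m' b ∸ toℕ r)}
  (<-≤-trans (≤-<-trans (+-monoʳ-≤ (s' b) (m∸n≤m (m' b) (toℕ r)))
                        (+-monoʳ-< (s' b) (n<1+n (m' b))))
             (fits b))

-- Elements of P_n(X): the chain x_1 < ... < x_n, plus the off-diagonal cells of each block
-- (cell i r e is the cell in row r at offset suc e).
data Elt {n k : ℕ} (X : Vec (Block n) k) : Set where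
  chain : Fin n → Elt X
  cell  : (i : Fin k) (r : Fin (suc (m' (lookup X i))))
        → Fin (lookup (lam (lookup X i)) r + (m' (lookup X i) ∸ toℕ r)) → Elt X

embed : ∀ {n k} (X : Vec (Block n) k) (i : Fin k) → SCell (lookup X i) → Elt X
embed X i (r , zero)  = chain (diagIdx (lookup X i) r)
embed X i (r , suc e) = cell i r e

data Gen {n k : ℕ} (X : Vec (Block n) k) : Elt X → Elt X → Set where
  chainGen : (j j' : Fin n) → suc (toℕ j) ≡ toℕ j' → Gen X (chain j) (chain j')
  blockGen : (i : Fin k) (a b : SCell (lookup X i)) → SLe (lookup X i) a b
           → Gen X (embed X i a) (embed X i b)

_≤P_ : ∀ {n k} {X : Vec (Block n) k} → Elt X → Elt X → Set
_≤P_ {X = X} = Star (Gen X)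

-- y has level j+1 (j 0-based)
Level : ∀ {n k} (X : Vec (Block n) k) → Fin n → Elt X → Set
Level X j y = (y ≤P chain j) × (∀ j' → suc (toℕ j') ≡ toℕ j → ¬ (y ≤P chain j'))

IsCount : {A : Set} → (A → Set) → ℕ → Set
IsCount {A} P c = Σ (List A) (λ xs → length xs ≡ c × Unique xs × (∀ x → P x ⇔ (x ∈ xs)))

IsQPartition : ∀ {n k} (X : Vec (Block n) k) → (Elt X → ℕ) → Set
IsQPartition X σ = ∀ x y → x ≤P y → σ y ≤ σ x

weightP : ∀ {n k} (X : Vec (Block n) k) → (Elt X → ℕ) → ℕ
weightP {n} {k} X σ =
  sumFin n (λ j → σ (chain j)) +
  sumFin k (λ i → sumFin (suc (m' (lookup X i))) (λ r →
    sumFin (lookup (lam (lookup X i)) r + (m' (lookup X i) ∸ toℕ r)) (λ e → σ (cell i r e))))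

IsSSYT : ∀ {n} (b : Block n) → (SCell b → ℕ) → Set
IsSSYT b T =
  (∀ r (e e' : Fin (rowLen b r)) → toℕ e ≤ toℕ e' → T (r , e) ≤ T (r , e')) ×
  (∀ (x y : SCell b) → suc (row b x) ≡ row b y → col b x ≡ col b y → T x < T y)

weightT : ∀ {n} (b : Block n) → (SCell b → ℕ) → ℕ
weightT b T = sumFin (suc (m' b)) (λ r → sumFin (rowLen b r) (λ e → T (r , e)))

diagEntries : ∀ {n} (b : Block n) → (SCell b → ℕ) → List ℕ
diagEntries b T = map (λ r → T (r , zero)) (allFin (suc (m' b)))

RDiagIs : ∀ {n} (b : Block n) → (SCell b → ℕ) → List ℕ → Set
RDiagIs b T ys = Linked _≥_ ys × (ys ↭ diagEntries b T)

subPart : ∀ {n} → Vec ℕ n → Block n → List ℕ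
subPart μ b = take (suc (m' b)) (drop (s' b) (toList μ))

shift : ∀ {n} → Vec ℕ n → ℕ
shift {n} ℓ = sumFin n (λ j → (n ∸ suc (toℕ j)) * lookup ℓ j)

-- coefficient of q^N in GF(P_n(X)): P_n(X)-partitions of weight N, up to pointwise equality
LHS : ∀ {n k} (X : Vec (Block n) k) → ℕ → Setoid 0ℓ 0ℓ
LHS X N = record
  { Carrier = Σ (Elt X → ℕ) (λ σ → IsQPartition X σ × weightP X σ ≡ N)
  ; _≈_ = λ a b → ∀ x → proj₁ a x ≡ proj₁ b x
  ; isEquivalence = record
      { refl = λ x → refl
      ; sym = λ p x → sym (p x)
      ; trans = λ p q x → trans (p x) (q x) } }

-- coefficient of q^{N + Σ(n-i)ℓ_i} in the sum over μ of q^{|μ|} Π_i Σ_T q^{|T| - |μ^[i]|}: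
-- tuples (μ, T_1..T_k) with μ strict, T_i SSYT with rdiag(T_i) = μ^[i],
-- and |μ| + Σ_i (|T_i| - |μ^[i]|) = N + Σ(n-i)ℓ_i (written without subtraction)
RHS : ∀ {n k} (X : Vec (Block n) k) → Vec ℕ n → ℕ → Setoid 0ℓ 0ℓ
RHS {n} {k} X ℓ N = record
  { Carrier = Σ (Vec ℕ n × ((i : Fin k) → SCell (lookup X i) → ℕ)) (λ { (μ , T) →
        Linked _>_ (toList μ)
      × (∀ i → IsSSYT (lookup X i) (T i))
      × (∀ i → RDiagIs (lookup X i) (T i) (subPart μ (lookup X i)))
      × (sum (toList μ) + sumFin k (λ i → weightT (lookup X i) (T i))
          ≡ N + shift ℓ + sumFin k (λ i → sum (subPart μ (lookup X i)))) })
  ; _≈_ = λ a b → (proj₁ (proj₁ a) ≡ proj₁ (proj₁ b))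
                × (∀ i c → proj₂ (proj₁ a) i c ≡ proj₂ (proj₁ b) i c)
  ; isEquivalence = record
      { refl = refl , λ i c → refl
      ; sym = λ { (p , q) → sym p , λ i c → sym (q i c) }
      ; trans = λ { (p , q) (p' , q') → trans p p' , λ i c → trans (q i c) (q' i c) } } }

module Submission where

open import Defs
open import Data.Nat using (ℕ; _≤_)
open import Data.Fin using (Fin)
open import Data.Vec using (Vec; lookup)
open import Function.Bundles using (Inverse)

open import Data.Nat using (zero; suc; _+_; _*_; _∸_; _<_; _≥_; _>_; z≤n; s≤s)
open import Data.Nat.Properties
open import Data.Nat.ListAction using (sum)
open import Data.Nat.ListAction.Properties using (sum-++; sum-↭)
open import Algebra.Properties.CommutativeSemigroup +-commutativeSemigroup using (interchange)
open import Data.Fin as F using (toℕ; fromℕ<; inject₁)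
open import Data.Fin.Properties using (toℕ-injective; toℕ<n; toℕ-fromℕ<; toℕ-inject₁)
open import Data.Vec as V using (toList; _∷_; [])
import Data.Vec.Properties as VP
open import Data.List as L using (List; map; take; drop; allFin; length; tabulate; reverse; concatMap; _++_)
open import Data.List.Properties using (map-tabulate; map-cong; map-++; map-∘; reverse-++; length-drop)
import Data.List.Properties as LP
open import Data.List.Membership.Propositional using (_∈_)
open import Data.List.Membership.Propositional.Properties
  using (∈-map⁺; ∈-map⁻; ∈-concat⁻′; ∈-concat⁺′; ∈-++⁺ˡ; ∈-++⁺ʳ; ∈-allFin)
open import Data.List.Membership.Propositional.Properties.WithK using (unique∧set⇒bag)
open import Data.List.Relation.Binary.BagAndSetEquality using (∼bag⇒↭)
open import Data.List.Relation.Unary.Any using (here; there)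
import Data.List.Relation.Unary.All as All
import Data.List.Relation.Unary.AllPairs as AllPairs
import Data.List.Relation.Unary.AllPairs.Properties as AllPairsP
open import Data.List.Relation.Unary.Linked as Linked using (Linked; [-])
open import Data.List.Relation.Unary.Linked.Properties using (Linked⇒AllPairs; AllPairs⇒Linked)
open import Data.List.Relation.Unary.Unique.Propositional using (Unique)
import Data.List.Relation.Unary.Unique.Propositional.Properties as UniqueP
open import Data.List.Relation.Binary.Permutation.Propositional
  using (_↭_; ↭-sym; ↭-trans; ↭-reflexive; ↭⇒↭ₛ)
import Data.List.Relation.Binary.Permutation.Propositional.Properties as PermP
open import Data.List.Relation.Unary.Sorted.TotalOrder.Properties using (↗↭↗⇒≋)
open import Data.List.Relation.Binary.Pointwise using (Pointwise-≡⇒≡)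
open import Data.Product using (Σ; _×_; _,_; proj₁; proj₂)
open import Data.Sum using (inj₁; inj₂)
open import Relation.Binary.PropositionalEquality
open import Relation.Binary.Bundles using (Setoid)
open import Relation.Binary.Construct.Closure.ReflexiveTransitive using (ε; _◅_; _◅◅_)
open import Function using (_∘_; id)
open import Function.Bundles using (Equivalence; mk⇔)
open import Relation.Nullary using (¬_)
open import Data.Empty using (⊥-elim)

-- Let level(y) be the index j of the lowest chain element x_j
-- above y, and coLevel(y) = n-1-level(y).  A P_n(X)-partition σ is sent to τ = σ + coLevel:
-- restricted to the chain, τ is a strictly decreasing μ (consecutive chain elements differ
-- by one in co-level), and restricted to the shifted diagram of block i it is a shifted
-- semistandard tableau T_i (rows share a co-level, going down a row adds one) whose
-- diagonal is μ^[i].  Conversely, rdiag(T_i) = μ^[i] forces the diagonal of T_i to read off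
-- μ (both are increasing, so a permutation between them is the identity), every value
-- dominates its co-level, and σ = τ - coLevel reverses every generating relation of P_n(X).
-- Weights match since Σ_y coLevel(y) = Σ_j (n-1-j) ℓ_j, obtained by grouping a
-- repetition-free enumeration of P_n(X) by levels.

sum-map-+ : ∀ {A : Set} (f g : A → ℕ) (xs : List A) →
            sum (map (λ x → f x + g x) xs) ≡ sum (map f xs) + sum (map g xs)
sum-map-+ f g L.[]       = refl
sum-map-+ f g (x L.∷ xs) =
  trans (cong (f x + g x +_) (sum-map-+ f g xs)) (interchange (f x) (g x) _ _)

sum-map-const : ∀ {A : Set} (g : A → ℕ) (c : ℕ) (xs : List A) →
                (∀ {x} → x ∈ xs → g x ≡ c) → sum (map g xs) ≡ c * length xs
sum-map-const g c L.[]       _     = sym (*-zeroʳ c)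
sum-map-const g c (x L.∷ xs) all-c =
  trans (cong₂ _+_ (all-c (here refl)) (sum-map-const g c xs (all-c ∘ there)))
        (sym (*-suc c (length xs)))

sum-concatMap : ∀ {A B : Set} (g : B → ℕ) (h : A → List B) (xs : List A) →
                sum (map g (concatMap h xs)) ≡ sum (map (λ x → sum (map g (h x))) xs)
sum-concatMap g h L.[]       = refl
sum-concatMap g h (x L.∷ xs) =
  trans (cong sum (map-++ g (h x) (concatMap h xs)))
        (trans (sum-++ (map g (h x)) _) (cong (sum (map g (h x)) +_) (sum-concatMap g h xs)))

sumFin-cong : ∀ m {f g : Fin m → ℕ} → (∀ j → f j ≡ g j) → sumFin m f ≡ sumFin m g
sumFin-cong m f≗g = cong sum (map-cong f≗g (allFin m))

sumFin-+ : ∀ m (f g : Fin m → ℕ) → sumFin m (λ j → f j + g j) ≡ sumFin m f + sumFin m g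
sumFin-+ m f g = sum-map-+ f g (allFin m)

sumFin-tabulate : ∀ m (g : Fin m → ℕ) → sumFin m g ≡ sum (tabulate g)
sumFin-tabulate m g = cong sum (map-tabulate id g)

sumFin-suc : ∀ m (g : Fin (suc m) → ℕ) → sumFin (suc m) g ≡ g F.zero + sumFin m (g ∘ F.suc)
sumFin-suc m g =
  cong (g F.zero +_) (cong sum (trans (map-tabulate F.suc g) (sym (map-tabulate id (g ∘ F.suc)))))

sum-toList : ∀ {n} (v : Vec ℕ n) → sum (toList v) ≡ sumFin n (lookup v)
sum-toList []             = refl
sum-toList {suc n} (x ∷ v) =
  trans (cong (x +_) (sum-toList v)) (sym (sumFin-suc n (lookup (x ∷ v))))

linked⇒adjacent : ∀ {A : Set} {R : A → A → Set} {n} (v : Vec A n) → Linked R (toList v) →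
                  ∀ i j → suc (toℕ i) ≡ toℕ j → R (lookup v i) (lookup v j)
linked⇒adjacent (x ∷ y ∷ v) (r Linked.∷ l) F.zero     (F.suc F.zero)     _  = r
linked⇒adjacent (x ∷ y ∷ v) (r Linked.∷ l) (F.suc i) (F.suc j) eq = linked⇒adjacent (y ∷ v) l i j (suc-injective eq)
linked⇒adjacent (x ∷ y ∷ v) _ F.zero     (F.suc (F.suc j)) ()
linked⇒adjacent (x ∷ y ∷ v) _ (F.suc i) F.zero            ()
linked⇒adjacent (x ∷ [])    _ F.zero     F.zero            ()

adjacent⇒linked : ∀ {A : Set} {R : A → A → Set} {n} (v : Vec A n) →
                  (∀ i j → suc (toℕ i) ≡ toℕ j → R (lookup v i) (lookup v j)) → Linked R (toList v)
adjacent⇒linked []          _   = Linked.[]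
adjacent⇒linked (x ∷ [])    _   = [-]
adjacent⇒linked (x ∷ y ∷ v) adj =
  adj F.zero (F.suc F.zero) refl Linked.∷ adjacent⇒linked (y ∷ v) (λ i j e → adj (F.suc i) (F.suc j) (cong suc e))

linked-tabulate : ∀ {A : Set} {R : A → A → Set} m (g : Fin (suc m) → A) →
                  (∀ (i : Fin m) → R (g (inject₁ i)) (g (F.suc i))) → Linked R (tabulate g)
linked-tabulate zero    g adj = [-]
linked-tabulate (suc m) g adj = adj F.zero Linked.∷ linked-tabulate m (g ∘ F.suc) (adj ∘ F.suc)

strict⇒staircase : ∀ {n} (μ : Vec ℕ n) → Linked _>_ (toList μ) → ∀ j → n ∸ suc (toℕ j) ≤ lookup μ j
strict⇒staircase (x ∷ [])    _               F.zero    = z≤n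
strict⇒staircase (x ∷ y ∷ v) (x>y Linked.∷ l) F.zero    = ≤-trans (s≤s (strict⇒staircase (y ∷ v) l F.zero)) x>y
strict⇒staircase (x ∷ v)     l               (F.suc j) = strict⇒staircase v (Linked.tail l) j

slice-decreasing : ∀ s t {xs : List ℕ} → Linked _>_ xs → Linked _≥_ (take t (drop s xs))
slice-decreasing s t l = AllPairs⇒Linked
  (AllPairsP.take⁺ t (AllPairsP.drop⁺ s (AllPairs.map <⇒≤ (Linked⇒AllPairs (λ p q → <-trans q p) l))))

increasing-↭ : ∀ {xs ys : List ℕ} → Linked _≤_ xs → Linked _≤_ ys → xs ↭ ys → xs ≡ ys
increasing-↭ xs↗ ys↗ p = Pointwise-≡⇒≡ (↗↭↗⇒≋ ≤-totalOrder xs↗ ys↗ (↭⇒↭ₛ p))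

tabulate-injective : ∀ {A : Set} {m} (f g : Fin m → A) → tabulate f ≡ tabulate g → ∀ i → f i ≡ g i
tabulate-injective f g eq F.zero    = proj₁ (LP.∷-injective eq)
tabulate-injective f g eq (F.suc i) = tabulate-injective (f ∘ F.suc) (g ∘ F.suc) (proj₂ (LP.∷-injective eq)) i

-- Indexing into a list of naturals (0 out of range), to describe slices μ^[b] read backwards.
nth : List ℕ → ℕ → ℕ
nth L.[]       _       = 0
nth (x L.∷ xs) zero    = x
nth (x L.∷ xs) (suc p) = nth xs p

lookup-nth : ∀ {n} (v : Vec ℕ n) (j : Fin n) → lookup v j ≡ nth (toList v) (toℕ j)
lookup-nth (x ∷ v) F.zero    = refl
lookup-nth (x ∷ v) (F.suc j) = lookup-nth v j

nth-drop : ∀ s xs p → nth (drop s xs) p ≡ nth xs (s + p)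
nth-drop zero    xs         p = refl
nth-drop (suc s) L.[]       p = refl
nth-drop (suc s) (x L.∷ xs) p = nth-drop s xs p

take-snoc : ∀ m xs → m < length xs → take (suc m) xs ≡ take m xs ++ L.[ nth xs m ]
take-snoc zero    (x L.∷ xs) _        = refl
take-snoc (suc m) (x L.∷ xs) (s≤s lt) = cong (x L.∷_) (take-snoc m xs lt)

reverse-take : ∀ m xs → suc m ≤ length xs →
               tabulate (λ (r : Fin (suc m)) → nth xs (m ∸ toℕ r)) ≡ reverse (take (suc m) xs)
reverse-take zero    (x L.∷ xs) _  = refl
reverse-take (suc m) xs         lt = begin
    nth xs (suc m) L.∷ tabulate (λ (r : Fin (suc m)) → nth xs (m ∸ toℕ r))
  ≡⟨ cong (nth xs (suc m) L.∷_) (reverse-take m xs (≤-trans (n≤1+n _) lt)) ⟩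
    nth xs (suc m) L.∷ reverse (take (suc m) xs)
  ≡⟨ sym (reverse-++ (take (suc m) xs) L.[ nth xs (suc m) ]) ⟩
    reverse (take (suc m) xs ++ L.[ nth xs (suc m) ])
  ≡⟨ cong reverse (sym (take-snoc (suc m) xs lt)) ⟩
    reverse (take (suc (suc m)) xs)
  ∎ where open ≡-Reasoning

∈-concatMap⁻ : ∀ {A B : Set} {h : A → List B} {v} (xs : List A) →
               v ∈ concatMap h xs → Σ A (λ x → x ∈ xs × v ∈ h x)
∈-concatMap⁻ {h = h} xs p with ∈-concat⁻′ (map h xs) p
... | ys , v∈ys , ys∈ with ∈-map⁻ h ys∈
...   | x , x∈xs , refl = x , x∈xs , v∈ys

∈-concatMap⁺ : ∀ {A B : Set} {h : A → List B} {v x} (xs : List A) →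
               x ∈ xs → v ∈ h x → v ∈ concatMap h xs
∈-concatMap⁺ {h = h} xs x∈xs v∈hx = ∈-concat⁺′ v∈hx (∈-map⁺ h x∈xs)

unique-concatMap : ∀ {A B K : Set} (key : A → K) (tag : B → K) (h : A → List B) (xs : List A) →
                   Unique (map key xs) → (∀ x → Unique (h x)) → (∀ x b → b ∈ h x → tag b ≡ key x) →
                   Unique (concatMap h xs)
unique-concatMap key tag h L.[]       _                      _     _      = AllPairs.[]
unique-concatMap key tag h (x L.∷ xs) (x∉xs AllPairs.∷ keys) h-uniq tagged =
  UniqueP.++⁺ (h-uniq x) (unique-concatMap key tag h xs keys h-uniq tagged) disjoint
  where
    disjoint : ∀ {v} → ¬ (v ∈ h x × v ∈ concatMap h xs)
    disjoint {v} (v∈hx , v∈rest) with ∈-concatMap⁻ xs v∈rest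
    ... | x' , x'∈xs , v∈hx' =
      All.lookup x∉xs (∈-map⁺ key x'∈xs) (trans (sym (tagged x v v∈hx)) (tagged x' v v∈hx'))

unique-same-members⇒↭ : ∀ {A : Set} {xs ys : List A} → Unique xs → Unique ys →
                         (∀ {v} → v ∈ xs → v ∈ ys) → (∀ {v} → v ∈ ys → v ∈ xs) → xs ↭ ys
unique-same-members⇒↭ uxs uys to from = ∼bag⇒↭ (unique∧set⇒bag uxs uys (mk⇔ to from))

sub-suc : ∀ m t → t < m → m ∸ t ≡ suc (m ∸ suc t)
sub-suc (suc m) zero    _        = refl
sub-suc (suc m) (suc t) (s≤s lt) = sub-suc m t lt

sub-split : ∀ m a c → c ≤ a → a ≤ m → m ∸ c ≡ (m ∸ a) + (a ∸ c)
sub-split m       a       zero    _        a≤m      = sym (m∸n+n≡m a≤m)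
sub-split (suc m) (suc a) (suc c) (s≤s c≤a) (s≤s a≤m) = sub-split m a c c≤a a≤m

coLevel-step : ∀ n t → suc t < n → n ∸ suc t ≡ suc (n ∸ suc (suc t))
coLevel-step n t lt = sub-suc n (suc t) lt

coLevel-gap : ∀ n t d → n ∸ suc t ≤ d + (n ∸ suc (t + d))
coLevel-gap n t d = begin
    n ∸ suc t
  ≤⟨ m≤n+m∸n (n ∸ suc t) d ⟩
    d + (n ∸ suc t ∸ d)
  ≡⟨ cong (d +_) (∸-+-assoc n (suc t) d) ⟩
    d + (n ∸ suc (t + d))
  ∎ where open ≤-Reasoning

monus-gap : ∀ {a c x y} d → d + c ≤ a → x ≤ d + y → c ∸ y ≤ a ∸ x
monus-gap {a} {c} {x} {y} d d+c≤a x≤d+y =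
  subst (_≤ a ∸ x) ([m+n]∸[m+o]≡n∸o d c y) (∸-mono d+c≤a x≤d+y)

lift-strict : ∀ {a c x y} → c ≤ a → x ≡ suc y → c + y < a + x
lift-strict {a} {c} {x} {y} c≤a refl = subst (c + y <_) (sym (+-suc a y)) (s≤s (+-monoˡ-≤ y c≤a))

-- Geometry of the shifted diagram of λ + δ_{m+1} attached to a block b.
module _ {n : ℕ} (b : Block n) where

  diagIdx-toℕ : ∀ r → toℕ (diagIdx b r) ≡ s' b + (m' b ∸ toℕ r)
  diagIdx-toℕ r = toℕ-fromℕ< _

  diagIdx-gap : ∀ ra rc → toℕ rc ≤ toℕ ra →
                toℕ (diagIdx b rc) ≡ toℕ (diagIdx b ra) + (toℕ ra ∸ toℕ rc)
  diagIdx-gap ra rc rc≤ra = begin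
      toℕ (diagIdx b rc)
    ≡⟨ diagIdx-toℕ rc ⟩
      s' b + (m' b ∸ toℕ rc)
    ≡⟨ cong (s' b +_) (sub-split (m' b) (toℕ ra) (toℕ rc) rc≤ra (≤-pred (toℕ<n ra))) ⟩
      s' b + ((m' b ∸ toℕ ra) + (toℕ ra ∸ toℕ rc))
    ≡⟨ sym (+-assoc (s' b) _ _) ⟩
      s' b + (m' b ∸ toℕ ra) + (toℕ ra ∸ toℕ rc)
    ≡⟨ cong (_+ (toℕ ra ∸ toℕ rc)) (sym (diagIdx-toℕ ra)) ⟩
      toℕ (diagIdx b ra) + (toℕ ra ∸ toℕ rc)
    ∎ where open ≡-Reasoning

  diagIdx-step : ∀ rx ry → suc (toℕ rx) ≡ toℕ ry → toℕ (diagIdx b rx) ≡ suc (toℕ (diagIdx b ry))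
  diagIdx-step rx ry eq = begin
      toℕ (diagIdx b rx)
    ≡⟨ diagIdx-toℕ rx ⟩
      s' b + (m' b ∸ toℕ rx)
    ≡⟨ cong (s' b +_) (sub-suc (m' b) (toℕ rx) (subst (_≤ m' b) (sym eq) (≤-pred (toℕ<n ry)))) ⟩
      s' b + suc (m' b ∸ suc (toℕ rx))
    ≡⟨ +-suc (s' b) _ ⟩
      suc (s' b + (m' b ∸ suc (toℕ rx)))
    ≡⟨ cong (λ z → suc (s' b + (m' b ∸ z))) eq ⟩
      suc (s' b + (m' b ∸ toℕ ry))
    ≡⟨ cong suc (sym (diagIdx-toℕ ry)) ⟩
      suc (toℕ (diagIdx b ry))
    ∎ where open ≡-Reasoning

  diagonal-slice : ∀ (μ : Vec ℕ n) → tabulate (λ r → lookup μ (diagIdx b r)) ≡ reverse (subPart μ b)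
  diagonal-slice μ =
    trans (LP.tabulate-cong (λ r → trans (lookup-nth μ _)
                                  (trans (cong (nth (toList μ)) (diagIdx-toℕ r))
                                         (sym (nth-drop (s' b) (toList μ) _)))))
          (reverse-take (m' b) (drop (s' b) (toList μ)) fits-length)
    where
      fits-length : suc (m' b) ≤ length (drop (s' b) (toList μ))
      fits-length rewrite length-drop (s' b) (toList μ) | VP.length-toList μ =
        subst (_≤ n ∸ s' b) (m+n∸m≡n (s' b) (suc (m' b))) (∸-monoˡ-≤ (s' b) (fits b))

  diagonal-sum : ∀ (μ : Vec ℕ n) → sumFin (suc (m' b)) (λ r → lookup μ (diagIdx b r)) ≡ sum (subPart μ b)
  diagonal-sum μ = trans (sumFin-tabulate (suc (m' b)) (λ r → lookup μ (diagIdx b r)))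
                         (trans (cong sum (diagonal-slice μ)) (sum-↭ (PermP.↭-reverse (subPart μ b))))

  rowLen-step : ∀ (i : Fin (m' b)) → suc (rowLen b (F.suc i)) ≤ rowLen b (inject₁ i)
  rowLen-step i rewrite toℕ-inject₁ i | sub-suc (m' b) (toℕ i) (toℕ<n i) =
    s≤s (≤-trans (≤-reflexive (sym (+-suc _ _)))
                 (+-monoˡ-≤ _ (linked⇒adjacent (lam b) (lamPar b) (inject₁ i) (F.suc i)
                                               (cong suc (toℕ-inject₁ i)))))

  above-fits : ∀ (i : Fin (m' b)) (e : Fin (rowLen b (F.suc i))) → suc (toℕ e) < rowLen b (inject₁ i)
  above-fits i e = ≤-trans (s≤s (toℕ<n e)) (rowLen-step i)

  above : ∀ (i : Fin (m' b)) → Fin (rowLen b (F.suc i)) → SCell b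
  above i e = inject₁ i , fromℕ< (above-fits i e)

  above-col : ∀ i e → col b (above i e) ≡ col b (F.suc i , e)
  above-col i e = trans (cong₂ _+_ (toℕ-inject₁ i) (toℕ-fromℕ< (above-fits i e))) (+-suc (toℕ i) (toℕ e))

  weightT-split : ∀ (T : SCell b → ℕ) →
    weightT b T ≡ sumFin (suc (m' b)) (λ r → T (r , F.zero))
                + sumFin (suc (m' b)) (λ r → sumFin (lookup (lam b) r + (m' b ∸ toℕ r)) (λ e → T (r , F.suc e)))
  weightT-split T =
    trans (sumFin-cong _ (λ r → sumFin-suc _ (λ e → T (r , e))))
          (sumFin-+ (suc (m' b)) (λ r → T (r , F.zero))
                    (λ r → sumFin (lookup (lam b) r + (m' b ∸ toℕ r)) (λ e → T (r , F.suc e))))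

  rdiag-of-diagonal : ∀ (T : SCell b → ℕ) (μ : Vec ℕ n) → Linked _>_ (toList μ) →
                      (∀ r → T (r , F.zero) ≡ lookup μ (diagIdx b r)) → RDiagIs b T (subPart μ b)
  rdiag-of-diagonal T μ μ↘ diag =
    slice-decreasing (s' b) (suc (m' b)) μ↘ ,
    ↭-trans (↭-sym (PermP.↭-reverse (subPart μ b)))
      (↭-reflexive (trans (sym (diagonal-slice μ))
        (trans (LP.tabulate-cong (λ r → sym (diag r))) (sym (map-tabulate id (λ r → T (r , F.zero)))))))

-- Facts about a semistandard tableau T of the shifted diagram of b.
module _ {n : ℕ} (b : Block n) (T : SCell b → ℕ) (ssyt : IsSSYT b T) where

  above-< : ∀ i e → T (above b i e) < T (F.suc i , e)
  above-< i e = proj₂ ssyt (above b i e) (F.suc i , e) (cong suc (toℕ-inject₁ i)) (above-col b i e)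

  ssyt-mono : ∀ a c → SLe b a c → (row b a ∸ row b c) + T c ≤ T a
  ssyt-mono (ra , ea) c = go (toℕ ra) ra ea refl c
    where
      go : ∀ t ra (ea : Fin (rowLen b ra)) → toℕ ra ≡ t → ∀ c → SLe b (ra , ea) c →
           (toℕ ra ∸ row b c) + T c ≤ T (ra , ea)
      go t ra ea _ (rc , ec) (rc≤ra , cols) with m≤n⇒m<n∨m≡n rc≤ra
      ... | inj₂ rc≡ra with toℕ-injective rc≡ra
      ...   | refl rewrite n∸n≡0 (toℕ ra) = proj₁ ssyt ra ec ea (+-cancelˡ-≤ (toℕ ra) _ _ cols)
      go t       F.zero    ea _  _ _ | inj₁ ()
      go zero    (F.suc i) ea () _ _ | inj₁ _
      go (suc t) (F.suc i) ea eq (rc , ec) (_ , cols) | inj₁ rc<ra = begin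
          (suc (toℕ i) ∸ toℕ rc) + T (rc , ec)
        ≡⟨ cong (_+ T (rc , ec)) (+-∸-assoc 1 rc≤i) ⟩
          suc ((toℕ i ∸ toℕ rc) + T (rc , ec))
        ≤⟨ s≤s (subst (λ z → (z ∸ toℕ rc) + T (rc , ec) ≤ T (above b i ea)) (toℕ-inject₁ i) ih) ⟩
          suc (T (above b i ea))
        ≤⟨ above-< i ea ⟩
          T (F.suc i , ea)
        ∎
        where
          open ≤-Reasoning
          rc≤i : toℕ rc ≤ toℕ i
          rc≤i = ≤-pred rc<ra
          ih : (toℕ (inject₁ i) ∸ toℕ rc) + T (rc , ec) ≤ T (above b i ea)
          ih = go t (inject₁ i) _ (trans (toℕ-inject₁ i) (suc-injective eq)) (rc , ec)
                  (subst (toℕ rc ≤_) (sym (toℕ-inject₁ i)) rc≤i ,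
                   subst (toℕ rc + toℕ ec ≤_) (sym (above-col b i ea)) cols)

  diagonal-increasing : ∀ (i : Fin (m' b)) → T (inject₁ i , F.zero) ≤ T (F.suc i , F.zero)
  diagonal-increasing i = ≤-trans (proj₁ ssyt (inject₁ i) F.zero _ z≤n) (<⇒≤ (above-< i F.zero))

  diagonal-of-rdiag : ∀ (μ : Vec ℕ n) → Linked _>_ (toList μ) → RDiagIs b T (subPart μ b) →
                      ∀ r → T (r , F.zero) ≡ lookup μ (diagIdx b r)
  diagonal-of-rdiag μ μ↘ rdiag = tabulate-injective _ _ (increasing-↭ T-diag↗ μ-diag↗ same)
    where
      T-diag↗ : Linked _≤_ (tabulate (λ r → T (r , F.zero)))
      T-diag↗ = linked-tabulate (m' b) (λ r → T (r , F.zero)) diagonal-increasing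
      μ-diag↗ : Linked _≤_ (tabulate (λ r → lookup μ (diagIdx b r)))
      μ-diag↗ = linked-tabulate (m' b) (λ r → lookup μ (diagIdx b r)) (λ i →
        <⇒≤ (linked⇒adjacent μ μ↘ (diagIdx b (F.suc i)) (diagIdx b (inject₁ i))
               (sym (diagIdx-step b (inject₁ i) (F.suc i) (cong suc (toℕ-inject₁ i))))))
      same : tabulate (λ r → T (r , F.zero)) ↭ tabulate (λ r → lookup μ (diagIdx b r))
      same = ↭-trans (↭-reflexive (sym (map-tabulate id (λ r → T (r , F.zero)))))
             (↭-trans (↭-sym (proj₂ rdiag))
             (↭-trans (↭-sym (PermP.↭-reverse (subPart μ b))) (↭-reflexive (sym (diagonal-slice b μ)))))

module Correspondence {n k : ℕ} (X : Vec (Block n) k) where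

  B : Fin k → Block n
  B i = lookup X i

  partition-from-generators : ∀ (σ : Elt X → ℕ) → (∀ a b → Gen X a b → σ b ≤ σ a) → IsQPartition X σ
  partition-from-generators σ gen a b ε       = ≤-refl
  partition-from-generators σ gen a b (g ◅ p) = ≤-trans (partition-from-generators σ gen _ b p) (gen _ _ g)

  level : Elt X → Fin n
  level (chain j)    = j
  level (cell i r e) = diagIdx (B i) r

  coLevel : Elt X → ℕ
  coLevel y = n ∸ suc (toℕ (level y))

  rowCoLevel : (i : Fin k) → Fin (suc (m' (B i))) → ℕ
  rowCoLevel i r = n ∸ suc (toℕ (diagIdx (B i) r))

  level-embed : ∀ i c → level (embed X i c) ≡ diagIdx (B i) (proj₁ c)
  level-embed i (r , F.zero)  = refl
  level-embed i (r , F.suc e) = refl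

  coLevel-embed : ∀ i c → coLevel (embed X i c) ≡ rowCoLevel i (proj₁ c)
  coLevel-embed i c = cong (λ l → n ∸ suc (toℕ l)) (level-embed i c)

  level-gen : ∀ {a b} → Gen X a b → toℕ (level a) ≤ toℕ (level b)
  level-gen (chainGen j j' eq) = subst (toℕ j ≤_) eq (n≤1+n _)
  level-gen (blockGen i a c (rc≤ra , _)) =
    subst₂ (λ u v → toℕ u ≤ toℕ v) (sym (level-embed i a)) (sym (level-embed i c))
      (≤-trans (m≤m+n _ _) (≤-reflexive (sym (diagIdx-gap (B i) (proj₁ a) (proj₁ c) rc≤ra))))

  level-mono : ∀ {a b} → a ≤P b → toℕ (level a) ≤ toℕ (level b)
  level-mono ε       = ≤-refl
  level-mono (g ◅ p) = ≤-trans (level-gen g) (level-mono p)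

  below-level : ∀ y → y ≤P chain (level y)
  below-level (chain j)    = ε
  below-level (cell i r e) = blockGen i (r , F.suc e) (r , F.zero) (≤-refl , +-monoʳ-≤ (toℕ r) z≤n) ◅ ε

  chain-path : ∀ d (a b : Fin n) → toℕ b ≡ toℕ a + d → _≤P_ {X = X} (chain a) (chain b)
  chain-path zero    a b eq with toℕ-injective (trans eq (+-identityʳ _))
  ... | refl = ε
  chain-path (suc d) a b eq =
    chain-path d a b' (toℕ-fromℕ< lt) ◅◅ (chainGen b' b (trans (cong suc (toℕ-fromℕ< lt)) (sym eq')) ◅ ε)
    where
      eq' : toℕ b ≡ suc (toℕ a + d)
      eq' = trans eq (+-suc _ _)
      lt : toℕ a + d < n
      lt = ≤-trans (≤-reflexive (sym eq')) (<⇒≤ (toℕ<n b))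
      b' : Fin n
      b' = fromℕ< lt

  chain-mono : ∀ (a b : Fin n) → toℕ a ≤ toℕ b → _≤P_ {X = X} (chain a) (chain b)
  chain-mono a b a≤b = chain-path (toℕ b ∸ toℕ a) a b (sym (m+[n∸m]≡n a≤b))

  level-sound : ∀ j y → Level X j y → level y ≡ j
  level-sound j y (y≤j , not-below-pred) with m≤n⇒m<n∨m≡n (level-mono y≤j)
  ... | inj₂ eq = toℕ-injective eq
  ... | inj₁ lt with toℕ j in eqj
  ...   | zero  = ⊥-elim (<-irrefl refl (≤-trans (s≤s z≤n) lt))
  ...   | suc p = ⊥-elim (not-below-pred j' (cong suc (toℕ-fromℕ< p<n))
                            (below-level y ◅◅ chain-mono (level y) j'
                               (subst (toℕ (level y) ≤_) (sym (toℕ-fromℕ< p<n)) (≤-pred lt))))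
    where
      p<n : p < n
      p<n = ≤-trans (n≤1+n _) (subst (_< n) eqj (toℕ<n j))
      j' : Fin n
      j' = fromℕ< p<n

  level-complete : ∀ j y → level y ≡ j → Level X j y
  level-complete .(level y) y refl =
    below-level y , λ j' eq y≤j' → <-irrefl refl (subst (_≤ toℕ j') (sym eq) (level-mono y≤j'))

  rowCells : (i : Fin k) → Fin (suc (m' (B i))) → List (Elt X)
  rowCells i r = map (cell i r) (allFin _)

  blockCells : Fin k → List (Elt X)
  blockCells i = concatMap (rowCells i) (allFin (suc (m' (B i))))

  elements : List (Elt X)
  elements = map chain (allFin n) ++ concatMap blockCells (allFin k)

  elements-complete : ∀ y → y ∈ elements
  elements-complete (chain j)    = ∈-++⁺ˡ (∈-map⁺ chain (∈-allFin j))
  elements-complete (cell i r e) = ∈-++⁺ʳ (map chain (allFin n))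
    (∈-concatMap⁺ (allFin k) (∈-allFin i)
      (∈-concatMap⁺ (allFin _) (∈-allFin r) (∈-map⁺ (cell i r) (∈-allFin e))))

  -- No repetitions: cells of distinct blocks (rows) are told apart by their block (row) index.
  elements-unique : Unique elements
  elements-unique = UniqueP.++⁺ (UniqueP.map⁺ chain-injective (UniqueP.allFin⁺ n)) cells-unique chain∉cells
    where
      chain-injective : ∀ {j j'} → chain {X = X} j ≡ chain j' → j ≡ j'
      chain-injective refl = refl
      cell-injective : ∀ {i r e e'} → cell {X = X} i r e ≡ cell i r e' → e ≡ e'
      cell-injective refl = refl
      blockOf rowOf : Elt X → ℕ
      blockOf (chain _)    = 0
      blockOf (cell i _ _) = toℕ i
      rowOf (chain _)    = 0
      rowOf (cell _ r _) = toℕ r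
      indices-unique : ∀ m → Unique (map toℕ (allFin m))
      indices-unique m = UniqueP.map⁺ toℕ-injective (UniqueP.allFin⁺ m)
      in-row : ∀ i r y → y ∈ rowCells i r → rowOf y ≡ toℕ r
      in-row i r y y∈ with ∈-map⁻ (cell i r) y∈
      ... | e , _ , refl = refl
      in-block : ∀ i y → y ∈ blockCells i → blockOf y ≡ toℕ i
      in-block i y y∈ with ∈-concatMap⁻ (allFin _) y∈
      ... | r , _ , y∈row with ∈-map⁻ (cell i r) y∈row
      ...   | e , _ , refl = refl
      cells-unique : Unique (concatMap blockCells (allFin k))
      cells-unique = unique-concatMap toℕ blockOf blockCells (allFin k) (indices-unique k)
        (λ i → unique-concatMap toℕ rowOf (rowCells i) (allFin _) (indices-unique _)
                 (λ r → UniqueP.map⁺ cell-injective (UniqueP.allFin⁺ _)) (in-row i))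
        in-block
      chain∉cells : ∀ {v} → ¬ (v ∈ map chain (allFin n) × v ∈ concatMap blockCells (allFin k))
      chain∉cells (v∈chain , v∈cells) with ∈-map⁻ chain v∈chain
      ... | j , _ , refl with ∈-concatMap⁻ (allFin k) v∈cells
      ...   | i , _ , v∈block with ∈-concatMap⁻ (allFin _) v∈block
      ...     | r , _ , v∈row with ∈-map⁻ (cell i r) v∈row
      ...       | _ , _ , ()

  sum-elements : ∀ g → sum (map g elements) ≡ weightP X g
  sum-elements g = begin
      sum (map g elements)
    ≡⟨ cong sum (map-++ g (map chain (allFin n)) _) ⟩
      sum (map g (map chain (allFin n)) ++ map g (concatMap blockCells (allFin k)))
    ≡⟨ sum-++ (map g (map chain (allFin n))) _ ⟩
      sum (map g (map chain (allFin n))) + sum (map g (concatMap blockCells (allFin k)))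
    ≡⟨ cong₂ _+_ (cong sum (sym (map-∘ (allFin n))))
                 (trans (sum-concatMap g blockCells (allFin k)) (cong sum (map-cong block-sum (allFin k)))) ⟩
      weightP X g
    ∎
    where
      open ≡-Reasoning
      block-sum : ∀ i → sum (map g (blockCells i))
                      ≡ sumFin (suc (m' (B i))) (λ r → sumFin (lookup (lam (B i)) r + (m' (B i) ∸ toℕ r))
                                                               (λ e → g (cell i r e)))
      block-sum i = trans (sum-concatMap g (rowCells i) (allFin _))
        (cong sum (map-cong (λ r → cong sum (sym (map-∘ {g = g} {f = cell i r} (allFin _)))) (allFin _)))

  weightP-+ : ∀ σ ρ → weightP X (λ y → σ y + ρ y) ≡ weightP X σ + weightP X ρ
  weightP-+ σ ρ = trans (sym (sum-elements _))
    (trans (sum-map-+ σ ρ elements) (cong₂ _+_ (sum-elements σ) (sum-elements ρ)))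

  weightP-cong : ∀ {σ ρ} → (∀ y → σ y ≡ ρ y) → weightP X σ ≡ weightP X ρ
  weightP-cong {σ} {ρ} σ≗ρ =
    trans (sym (sum-elements σ)) (trans (cong sum (map-cong σ≗ρ elements)) (sum-elements ρ))

  -- The total shift Σ_y (n-1-level y) equals Σ_j (n-1-j) ℓ_j: group the elements by level.
  weightP-coLevel : (ℓ : Vec ℕ n) → (∀ (j : Fin n) → IsCount (Level X j) (lookup ℓ j)) →
                    weightP X coLevel ≡ shift ℓ
  weightP-coLevel ℓ count = begin
      weightP X coLevel
    ≡⟨ sym (sum-elements coLevel) ⟩
      sum (map coLevel elements)
    ≡⟨ sum-↭ (PermP.map⁺ coLevel elements↭byLevel) ⟩
      sum (map coLevel byLevel)
    ≡⟨ sum-concatMap coLevel levelList (allFin n) ⟩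
      sumFin n (λ j → sum (map coLevel (levelList j)))
    ≡⟨ sumFin-cong n (λ j → sum-map-const coLevel _ (levelList j) (cong (λ l → n ∸ suc (toℕ l)) ∘ on-level j)) ⟩
      sumFin n (λ j → (n ∸ suc (toℕ j)) * length (levelList j))
    ≡⟨ sumFin-cong n (λ j → cong ((n ∸ suc (toℕ j)) *_) (proj₁ (proj₂ (count j)))) ⟩
      shift ℓ
    ∎
    where
      open ≡-Reasoning
      levelList : Fin n → List (Elt X)
      levelList j = proj₁ (count j)
      byLevel : List (Elt X)
      byLevel = concatMap levelList (allFin n)
      on-level : ∀ j {y} → y ∈ levelList j → level y ≡ j
      on-level j {y} y∈ = level-sound j y (Equivalence.from (proj₂ (proj₂ (proj₂ (count j))) y) y∈)
      elements↭byLevel : elements ↭ byLevel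
      elements↭byLevel = unique-same-members⇒↭ elements-unique
        (unique-concatMap id level levelList (allFin n) (UniqueP.map⁺ id (UniqueP.allFin⁺ n))
           (λ j → proj₁ (proj₂ (proj₂ (count j)))) (λ j y → on-level j))
        (λ {y} _ → ∈-concatMap⁺ (allFin n) (∈-allFin (level y))
                      (Equivalence.to (proj₂ (proj₂ (proj₂ (count (level y)))) y) (level-complete _ y refl)))
        (λ {y} _ → elements-complete y)

  -- A pair (μ, T) read as a function on P_n(X): chain elements read μ, the
  -- off-diagonal cells read T (diagonal cells are identified with chain elements).
  merge : Vec ℕ n → ((i : Fin k) → SCell (B i) → ℕ) → Elt X → ℕ
  merge μ T (chain j)    = lookup μ j
  merge μ T (cell i r e) = T i (r , F.suc e)

  merge-cong : ∀ {μ μ' T T'} → μ ≡ μ' → (∀ i c → T i c ≡ T' i c) → ∀ y → merge μ T y ≡ merge μ' T' y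
  merge-cong μ≡μ' T≗T' (chain j)    = cong (λ v → lookup v j) μ≡μ'
  merge-cong μ≡μ' T≗T' (cell i r e) = T≗T' i (r , F.suc e)

  weight-merge : ∀ μ T → (∀ i r → T i (r , F.zero) ≡ lookup μ (diagIdx (B i) r)) →
    sum (toList μ) + sumFin k (λ i → weightT (B i) (T i))
      ≡ weightP X (merge μ T) + sumFin k (λ i → sum (subPart μ (B i)))
  weight-merge μ T diag = begin
      sum (toList μ) + sumFin k (λ i → weightT (B i) (T i))
    ≡⟨ cong₂ _+_ (sum-toList μ) (trans (sumFin-cong k block) (sumFin-+ k D E)) ⟩
      sumFin n (lookup μ) + (sumFin k D + sumFin k E)
    ≡⟨ cong (sumFin n (lookup μ) +_) (+-comm (sumFin k D) (sumFin k E)) ⟩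
      sumFin n (lookup μ) + (sumFin k E + sumFin k D)
    ≡⟨ sym (+-assoc (sumFin n (lookup μ)) _ _) ⟩
      weightP X (merge μ T) + sumFin k D
    ∎
    where
      open ≡-Reasoning
      D E : Fin k → ℕ
      D i = sum (subPart μ (B i))
      E i = sumFin (suc (m' (B i))) (λ r → sumFin (lookup (lam (B i)) r + (m' (B i) ∸ toℕ r))
                                                 (λ e → T i (r , F.suc e)))
      block : ∀ i → weightT (B i) (T i) ≡ D i + E i
      block i = trans (weightT-split (B i) (T i))
        (cong (_+ E i) (trans (sumFin-cong _ (diag i)) (diagonal-sum (B i) μ)))

  module Forward (σ : Elt X → ℕ) (σ-part : IsQPartition X σ) where

    μ : Vec ℕ n
    μ = V.tabulate (λ j → σ (chain j) + coLevel (chain j))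

    T : (i : Fin k) → SCell (B i) → ℕ
    T i c = σ (embed X i c) + rowCoLevel i (proj₁ c)

    merge-lift : ∀ y → merge μ T y ≡ σ y + coLevel y
    merge-lift (chain j)    = VP.lookup∘tabulate _ j
    merge-lift (cell i r e) = refl

    -- Consecutive chain elements differ by one in co-level, so μ decreases strictly.
    μ-strict : Linked _>_ (toList μ)
    μ-strict = adjacent⇒linked μ (λ j j' eq →
      subst₂ _>_ (sym (merge-lift (chain j))) (sym (merge-lift (chain j')))
        (lift-strict (σ-part _ _ (chainGen j j' eq ◅ ε))
                     (trans (coLevel-step n (toℕ j) (subst (_< n) (sym eq) (toℕ<n j')))
                            (cong (λ t → suc (n ∸ suc t)) eq))))

    -- A row shares one co-level; one row down adds one to it, making columns strict.
    T-ssyt : ∀ i → IsSSYT (B i) (T i)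
    T-ssyt i = rows , columns
      where
        rows : ∀ r (e e' : Fin (rowLen (B i) r)) → toℕ e ≤ toℕ e' → T i (r , e) ≤ T i (r , e')
        rows r e e' e≤e' = +-monoˡ-≤ _
          (σ-part _ _ (blockGen i (r , e') (r , e) (≤-refl , +-monoʳ-≤ (toℕ r) e≤e') ◅ ε))
        columns : ∀ (x y : SCell (B i)) → suc (row (B i) x) ≡ row (B i) y → col (B i) x ≡ col (B i) y →
                  T i x < T i y
        columns (rx , ex) (ry , ey) rx+1≡ry cx≡cy = lift-strict
          (σ-part _ _ (blockGen i (ry , ey) (rx , ex) (subst (toℕ rx ≤_) rx+1≡ry (n≤1+n _) , ≤-reflexive cx≡cy) ◅ ε))
          (trans (coLevel-step n (toℕ (diagIdx (B i) ry)) (subst (_< n) step (toℕ<n (diagIdx (B i) rx))))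
                 (cong (λ t → suc (n ∸ suc t)) (sym step)))
          where
            step : toℕ (diagIdx (B i) rx) ≡ suc (toℕ (diagIdx (B i) ry))
            step = diagIdx-step (B i) rx ry rx+1≡ry

    T-diagonal : ∀ i r → T i (r , F.zero) ≡ lookup μ (diagIdx (B i) r)
    T-diagonal i r = sym (merge-lift (chain (diagIdx (B i) r)))

    T-rdiag : ∀ i → RDiagIs (B i) (T i) (subPart μ (B i))
    T-rdiag i = rdiag-of-diagonal (B i) (T i) μ μ-strict (T-diagonal i)

  module Backward (μ : Vec ℕ n) (T : (i : Fin k) → SCell (B i) → ℕ)
                  (μ-strict : Linked _>_ (toList μ)) (T-ssyt : ∀ i → IsSSYT (B i) (T i))
                  (T-rdiag : ∀ i → RDiagIs (B i) (T i) (subPart μ (B i))) where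

    T-diagonal : ∀ i r → T i (r , F.zero) ≡ lookup μ (diagIdx (B i) r)
    T-diagonal i = diagonal-of-rdiag (B i) (T i) (T-ssyt i) μ μ-strict (T-rdiag i)

    merge-embed : ∀ i c → merge μ T (embed X i c) ≡ T i c
    merge-embed i (r , F.zero)  = sym (T-diagonal i r)
    merge-embed i (r , F.suc e) = refl

    -- Every value is at least the co-level of its element, so subtracting it loses nothing.
    coLevel≤merge : ∀ y → coLevel y ≤ merge μ T y
    coLevel≤merge (chain j)    = strict⇒staircase μ μ-strict j
    coLevel≤merge (cell i r e) = ≤-trans (strict⇒staircase μ μ-strict (diagIdx (B i) r))
      (subst (_≤ T i (r , F.suc e)) (T-diagonal i r) (proj₁ (T-ssyt i) r F.zero (F.suc e) z≤n))

    σ : Elt X → ℕ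
    σ y = merge μ T y ∸ coLevel y

    σ-lift : ∀ y → σ y + coLevel y ≡ merge μ T y
    σ-lift y = m∸n+n≡m (coLevel≤merge y)

    σ-embed-lift : ∀ i c → σ (embed X i c) + rowCoLevel i (proj₁ c) ≡ T i c
    σ-embed-lift i c = trans (cong (σ (embed X i c) +_) (sym (coLevel-embed i c)))
                             (trans (σ-lift (embed X i c)) (merge-embed i c))

    -- σ reverses each generating relation: along the chain since μ is strict, inside a
    -- block since T grows at least as fast as the co-level when going down rows.
    σ-gen : ∀ a b → Gen X a b → σ b ≤ σ a
    σ-gen _ _ (chainGen j j' eq) = monus-gap 1 (linked⇒adjacent μ μ-strict j j' eq)
      (≤-reflexive (trans (coLevel-step n (toℕ j) (subst (_< n) (sym eq) (toℕ<n j')))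
                          (cong (λ t → suc (n ∸ suc t)) eq)))
    σ-gen _ _ (blockGen i a c sle) =
      subst₂ _≤_ (sym (σ-embed c)) (sym (σ-embed a))
        (monus-gap (toℕ (proj₁ a) ∸ toℕ (proj₁ c)) (ssyt-mono (B i) (T i) (T-ssyt i) a c sle)
          (subst (λ t → rowCoLevel i (proj₁ a) ≤ (toℕ (proj₁ a) ∸ toℕ (proj₁ c)) + (n ∸ suc t))
                 (sym (diagIdx-gap (B i) (proj₁ a) (proj₁ c) (proj₁ sle)))
                 (coLevel-gap n (toℕ (diagIdx (B i) (proj₁ a))) _)))
      where
        σ-embed : ∀ x → σ (embed X i x) ≡ T i x ∸ rowCoLevel i (proj₁ x)
        σ-embed x = cong₂ _∸_ (merge-embed i x) (coLevel-embed i x)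

    σ-part : IsQPartition X σ
    σ-part = partition-from-generators σ σ-gen

  module Bijection (ℓ : Vec ℕ n) (count : ∀ (j : Fin n) → IsCount (Level X j) (lookup ℓ j)) (N : ℕ) where

    to : Setoid.Carrier (LHS X N) → Setoid.Carrier (RHS X ℓ N)
    to (σ , σ-part , weight) = (μ , T) , μ-strict , T-ssyt , T-rdiag , weight-eq
      where
        open Forward σ σ-part
        S = sumFin k (λ i → sum (subPart μ (B i)))
        weight-eq : sum (toList μ) + sumFin k (λ i → weightT (B i) (T i)) ≡ N + shift ℓ + S
        weight-eq = begin
            sum (toList μ) + sumFin k (λ i → weightT (B i) (T i))
          ≡⟨ weight-merge μ T T-diagonal ⟩
            weightP X (merge μ T) + S
          ≡⟨ cong (_+ S) (trans (weightP-cong merge-lift) (weightP-+ σ coLevel)) ⟩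
            weightP X σ + weightP X coLevel + S
          ≡⟨ cong (_+ S) (cong₂ _+_ weight (weightP-coLevel ℓ count)) ⟩
            N + shift ℓ + S
          ∎ where open ≡-Reasoning

    from : Setoid.Carrier (RHS X ℓ N) → Setoid.Carrier (LHS X N)
    from ((μ , T) , μ-strict , T-ssyt , T-rdiag , weight) =
      σ , σ-part , +-cancelʳ-≡ (shift ℓ) _ _ (+-cancelʳ-≡ S _ _ weight-eq)
      where
        open Backward μ T μ-strict T-ssyt T-rdiag
        S = sumFin k (λ i → sum (subPart μ (B i)))
        weight-eq : weightP X σ + shift ℓ + S ≡ N + shift ℓ + S
        weight-eq = begin
            weightP X σ + shift ℓ + S
          ≡⟨ cong (λ t → weightP X σ + t + S) (sym (weightP-coLevel ℓ count)) ⟩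
            weightP X σ + weightP X coLevel + S
          ≡⟨ cong (_+ S) (trans (sym (weightP-+ σ coLevel)) (weightP-cong σ-lift)) ⟩
            weightP X (merge μ T) + S
          ≡⟨ sym (weight-merge μ T T-diagonal) ⟩
            sum (toList μ) + sumFin k (λ i → weightT (B i) (T i))
          ≡⟨ weight ⟩
            N + shift ℓ + S
          ∎ where open ≡-Reasoning

    to-cong : ∀ {x y} → Setoid._≈_ (LHS X N) x y → Setoid._≈_ (RHS X ℓ N) (to x) (to y)
    to-cong σ≗σ' = VP.tabulate-cong (λ j → cong (_+ coLevel (chain j)) (σ≗σ' (chain j))) ,
                   λ i c → cong (_+ rowCoLevel i (proj₁ c)) (σ≗σ' (embed X i c))

    from-cong : ∀ {x y} → Setoid._≈_ (RHS X ℓ N) x y → Setoid._≈_ (LHS X N) (from x) (from y)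
    from-cong (μ≡μ' , T≗T') y = cong (_∸ coLevel y) (merge-cong μ≡μ' T≗T' y)

    to-from : ∀ {x y} → Setoid._≈_ (LHS X N) y (from x) → Setoid._≈_ (RHS X ℓ N) (to y) x
    to-from {(μ , T) , μ-strict , T-ssyt , T-rdiag , _} y≗ =
      trans (VP.tabulate-cong (λ j → trans (cong (_+ coLevel (chain j)) (y≗ (chain j))) (σ-lift (chain j))))
            (VP.tabulate∘lookup μ) ,
      λ i c → trans (cong (_+ rowCoLevel i (proj₁ c)) (y≗ (embed X i c))) (σ-embed-lift i c)
      where open Backward μ T μ-strict T-ssyt T-rdiag

    from-to : ∀ {x y} → Setoid._≈_ (RHS X ℓ N) y (to x) → Setoid._≈_ (LHS X N) (from y) x
    from-to {σ , σ-part , _} (μ≡ , T≗) z =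
      trans (cong (_∸ coLevel z) (trans (merge-cong μ≡ T≗ z) (Forward.merge-lift σ σ-part z)))
            (m+n∸n≡m (σ z) (coLevel z))

lemma5p5 : (n k : ℕ) → 1 ≤ n → 1 ≤ k → (X : Vec (Block n) k)
    → (ℓ : Vec ℕ n) → (∀ (j : Fin n) → IsCount (Level X j) (lookup ℓ j))
    → (N : ℕ) → Inverse (LHS X N) (RHS X ℓ N)
lemma5p5 n k _ _ X ℓ count N = record
  { to        = to
  ; from      = from
  ; to-cong   = λ {x} {y} → to-cong {x} {y}
  ; from-cong = λ {x} {y} → from-cong {x} {y}
  ; inverse   = (λ {x} {y} → to-from {x} {y}) , (λ {x} {y} → from-to {x} {y})
  }
  where open Correspondence.Bijection X ℓ count N
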